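{- For every $n$, the restriction of the middle order $\mathcal{P}_n$ to the set of $132$-avoiding permutations of size $n$ coincides with the restriction of the weak order to that set: for $132$-avoiding $v,w\in S_n$, $v\le w$ in $\mathcal{P}_n$ if and only if $v\le w$ in the weak order.
   Context: For $w\in S_n$ (one-line notation), its inversion sequence is $I(w)=(x_1,\ldots,x_n)$ with $x_i=\#\{j<i : w^{ -1}(j)>w^{ -1}(i)\}$. The middle order $\mathcal{P}_n$ on $S_n$: $v\le w$ iff $I(v)\le I(w)$ coordinate-wise. The weak order on $S_n$ is the transitive closure of the relations $v<w$ where $w$ is obtained from $v$ by swapping two adjacent entries $v(i)<v(i+1)$. A permutation avoids $132$ if it has no indices $i<j<k$ with $w(i)<w(k)<w(j)$. -}

module Defs where

open import Data.Nat using (ℕ; suc)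
open import Data.Fin using (Fin; toℕ; _<_; _<?_)
open import Data.Fin.Permutation using (Permutation′; _⟨$⟩ʳ_; _⟨$⟩ˡ_)
open import Data.List using (List; length; filter; allFin)
open import Data.Product using (Σ; _×_; ∃)
open import Data.Sum using (_⊎_)
open import Relation.Nullary using (¬_)
open import Relation.Binary.PropositionalEquality using (_≡_; _≢_)
open import Relation.Binary.Construct.Closure.ReflexiveTransitive using (Star)

-- Permutations of size n are bijections Fin n ↔ Fin n; w(i) = w ⟨$⟩ʳ i
-- (entries and positions are 0-based: an order-preserving relabelling of [n]).

inversionSeq : ∀ {n} → Permutation′ n → Fin n → ℕ
inversionSeq {n} w i =
  length (filter (λ j → j <? i) (filter (λ j → (w ⟨$⟩ˡ i) <? (w ⟨$⟩ˡ j)) (allFin n)))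

_≤ᴾ_ : ∀ {n} → Permutation′ n → Permutation′ n → Set
_≤ᴾ_ {n} v w = ∀ (i : Fin n) → inversionSeq v i Data.Nat.≤ inversionSeq w i

AdjSwapUp : ∀ {n} → Permutation′ n → Permutation′ n → Set
AdjSwapUp {n} v w =
  Σ (Fin n) λ i → Σ (Fin n) λ j →
    (toℕ j ≡ suc (toℕ i)) ×
    ((v ⟨$⟩ʳ i) < (v ⟨$⟩ʳ j)) ×
    ((w ⟨$⟩ʳ i) ≡ (v ⟨$⟩ʳ j)) ×
    ((w ⟨$⟩ʳ j) ≡ (v ⟨$⟩ʳ i)) ×
    (∀ (k : Fin n) → k ≢ i → k ≢ j → (w ⟨$⟩ʳ k) ≡ (v ⟨$⟩ʳ k))

-- Permutations are compared as functions (pointwise equality), since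
-- the bijection records also carry proof components.
SamePerm : ∀ {n} → Permutation′ n → Permutation′ n → Set
SamePerm {n} v w = ∀ (k : Fin n) → (v ⟨$⟩ʳ k) ≡ (w ⟨$⟩ʳ k)

WeakStep : ∀ {n} → Permutation′ n → Permutation′ n → Set
WeakStep v w = AdjSwapUp v w ⊎ SamePerm v w

_≤ᵂ_ : ∀ {n} → Permutation′ n → Permutation′ n → Set
v ≤ᵂ w = Star WeakStep v w

Avoids132 : ∀ {n} → Permutation′ n → Set
Avoids132 {n} w =
  ¬ (Σ (Fin n) λ i → Σ (Fin n) λ j → Σ (Fin n) λ k →
       (i < j) × (j < k) × ((w ⟨$⟩ʳ i) < (w ⟨$⟩ʳ k)) × ((w ⟨$⟩ʳ k) < (w ⟨$⟩ʳ j)))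

-- Compare permutations through their inversion sets Inv v = {(a, b) : a < b, b occurs before a}.
-- The weak order is inclusion of inversion sets: an adjacent swap up adds exactly one inversion,
-- and if Inv v ⊆ Inv w with some (a, b) ∈ Inv w ∖ Inv v, then some adjacent ascent of v lying
-- between the positions of a and b is inverted in w, and swapping it keeps the inclusion.
-- Inclusion always implies the middle order, as I(v)_b counts the inversions (a, b). For
-- 132-avoiders the converse holds: if (a, b) ∈ Inv v ∖ Inv w, avoidance of 132 in v and in w
-- turns every inversion (c, b) of w into one of v, so I(w)_b < I(v)_b.
module Submission where

open import Defs
open import Data.Fin.Base using (Fin; toℕ; fromℕ<; _<_)
open import Data.Fin.Properties
  using (_≟_; _<?_; any?; <-cmp; <-irrefl; <-asym; <-trans; <⇒≢; ≤∧≢⇒<; toℕ<n; toℕ-fromℕ<)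
open import Data.Fin.Induction using (<-wellFounded)
open import Data.Fin.Permutation
  using (Permutation′; _⟨$⟩ʳ_; _⟨$⟩ˡ_; inverseˡ; inverseʳ; transpose; _∘ₚ_)
import Data.Fin.Permutation.Components as PC
open import Data.List.Base using ([]; _∷_; length; filter; allFin; cartesianProduct)
open import Data.List.Properties using (filter-accept; filter-reject; filter-≐)
open import Data.List.Membership.Propositional using (_∈_)
open import Data.List.Membership.Propositional.Properties using (∈-allFin; ∈-cartesianProduct⁺)
open import Data.List.Relation.Unary.Any using (here; there)
open import Data.List.Relation.Binary.Sublist.Propositional using (⊆-refl)
import Data.List.Relation.Binary.Sublist.Propositional.Properties as Sublist
open import Data.Nat.Base as ℕ using (ℕ; zero; suc; _+_; s≤s; z<s)
import Data.Nat.Properties as ℕ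
open import Data.Product using (Σ; ∃₂; _×_; _,_; uncurry; <_,_>)
open import Data.Sum using (_⊎_; inj₁; inj₂)
open import Function using (_∘_)
open import Induction.WellFounded using (module All)
open import Relation.Nullary using (¬_; Dec; yes; no; _×-dec_; ¬?)
open import Relation.Nullary.Decidable using (map′; decidable-stable; dec-true; dec-false)
open import Relation.Nullary.Negation using (contradiction)
open import Relation.Unary using (Pred; Decidable; _⊆_)
open import Relation.Binary.Definitions using (tri<; tri≈; tri>)
open import Relation.Binary.PropositionalEquality
  using (_≡_; _≢_; refl; sym; trans; cong; subst; subst₂; module ≡-Reasoning)
open import Relation.Binary.Construct.Closure.ReflexiveTransitive using (ε; _◅_; fold)

module _ {a p q} {A : Set a} {P : Pred A p} {Q : Pred A q}
         (P? : Decidable P) (Q? : Decidable Q) where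

  filter-filter : ∀ xs → filter P? (filter Q? xs) ≡ filter (λ x → P? x ×-dec Q? x) xs
  filter-filter [] = refl
  filter-filter (x ∷ xs) with P? x | Q? x
  ... | no _   | no _  = filter-filter xs
  ... | no ¬px | yes _ = trans (filter-reject P? ¬px) (filter-filter xs)
  ... | yes _  | no _  = filter-filter xs
  ... | yes px | yes _ = trans (filter-accept P? px) (cong (x ∷_) (filter-filter xs))

  length-filter-mono-≤ : P ⊆ Q → ∀ xs → length (filter P? xs) ℕ.≤ length (filter Q? xs)
  length-filter-mono-≤ P⊆Q xs =
    Sublist.length-mono-≤ (Sublist.filter⁺ P? Q? (λ { refl → P⊆Q }) (⊆-refl {x = xs}))

  length-filter-mono-< : P ⊆ Q → ∀ {x xs} → x ∈ xs → Q x → ¬ P x →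
                         length (filter P? xs) ℕ.< length (filter Q? xs)
  length-filter-mono-< P⊆Q {xs = y ∷ ys} (here refl) qx ¬px with P? y | Q? y
  ... | yes px | _      = contradiction px ¬px
  ... | no _   | no ¬qx = contradiction qx ¬qx
  ... | no _   | yes _  = s≤s (length-filter-mono-≤ P⊆Q ys)
  length-filter-mono-< P⊆Q {xs = y ∷ ys} (there x∈ys) qx ¬px
    with length-filter-mono-< P⊆Q x∈ys qx ¬px | P? y | Q? y
  ... | _  | yes py | no ¬qy = contradiction (P⊆Q py) ¬qy
  ... | lt | yes _  | yes _  = s≤s lt
  ... | lt | no _   | yes _  = ℕ.m<n⇒m<1+n lt
  ... | lt | no _   | no _   = lt

private
  variable
    n : ℕ
    u v w : Permutation′ n
    a b c i j s r t : Fin n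

≮∧≢⇒> : ∀ {x y : Fin n} → ¬ x < y → x ≢ y → y < x
≮∧≢⇒> x≮y x≢y = ≤∧≢⇒< (ℕ.≮⇒≥ x≮y) (x≢y ∘ sym)

⟨$⟩ˡ-injective : (v : Permutation′ n) → v ⟨$⟩ˡ a ≡ v ⟨$⟩ˡ b → a ≡ b
⟨$⟩ˡ-injective v e = trans (sym (inverseʳ v)) (trans (cong (v ⟨$⟩ʳ_) e) (inverseʳ v))

⟨$⟩ˡ≡⇒⟨$⟩ʳ≡ : (v : Permutation′ n) → v ⟨$⟩ˡ a ≡ i → v ⟨$⟩ʳ i ≡ a
⟨$⟩ˡ≡⇒⟨$⟩ʳ≡ v e = trans (cong (v ⟨$⟩ʳ_) (sym e)) (inverseʳ v)

⟨$⟩ʳ-injective : (v : Permutation′ n) → v ⟨$⟩ʳ i ≡ v ⟨$⟩ʳ j → i ≡ j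
⟨$⟩ʳ-injective v e = trans (sym (inverseˡ v)) (trans (cong (v ⟨$⟩ˡ_) e) (inverseˡ v))

adjacent⇒< : toℕ j ≡ suc (toℕ i) → i < j
adjacent⇒< j≡1+i = ℕ.≤-reflexive (sym j≡1+i)

record Swaps (i j : Fin n) (f : Fin n → Fin n) : Set where
  field
    map-i     : f i ≡ j
    map-j     : f j ≡ i
    map-other : ∀ {k} → k ≢ i → k ≢ j → f k ≡ k

open Swaps

transpose-swaps : i ≢ j → Swaps i j (PC.transpose i j)
transpose-swaps {i = i} i≢j .map-i rewrite dec-true (i ≟ i) refl = refl
transpose-swaps {i = i} {j} i≢j .map-j
  rewrite dec-false (j ≟ i) (i≢j ∘ sym) | dec-true (j ≟ j) refl = refl
transpose-swaps {i = i} {j} i≢j .map-other {k} k≢i k≢j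
  rewrite dec-false (k ≟ i) k≢i | dec-false (k ≟ j) k≢j = refl

swap-adjacent-< : ∀ {f} {p q : Fin n} → toℕ j ≡ suc (toℕ i) → Swaps i j f →
                  p < q → ¬ (p ≡ i × q ≡ j) → f p < f q
swap-adjacent-< {j = j} {i = i} {p = p} {q = q} j≡1+i sw p<q ¬ij with p ≟ i | p ≟ j
... | yes refl | _ = subst₂ _<_ (sym (map-i sw)) (sym (map-other sw (<⇒≢ p<q ∘ sym) q≢j)) j<q
  where
  q≢j : q ≢ j
  q≢j = ¬ij ∘ (refl ,_)
  j<q : j < q
  j<q = ≤∧≢⇒< (subst (ℕ._≤ toℕ q) (sym j≡1+i) p<q) (q≢j ∘ sym)
... | no _ | yes refl =
  subst₂ _<_ (sym (map-j sw)) (sym (map-other sw (<⇒≢ i<q ∘ sym) (<⇒≢ p<q ∘ sym))) i<q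
  where
  i<q : i < q
  i<q = <-trans (adjacent⇒< j≡1+i) p<q
... | no p≢i | no p≢j with q ≟ i | q ≟ j
...   | yes refl | _ =
  subst₂ _<_ (sym (map-other sw p≢i p≢j)) (sym (map-i sw)) (<-trans p<q (adjacent⇒< j≡1+i))
...   | no _ | yes refl = subst₂ _<_ (sym (map-other sw p≢i p≢j)) (sym (map-j sw)) p<i
  where
  p<i : p < i
  p<i = ≤∧≢⇒< (ℕ.≤-pred (subst (suc (toℕ p) ℕ.≤_) j≡1+i p<q)) p≢i
...   | no q≢i | no q≢j =
  subst₂ _<_ (sym (map-other sw p≢i p≢j)) (sym (map-other sw q≢i q≢j)) p<q

record Inv (v : Permutation′ n) (a b : Fin n) : Set where
  constructor inversion
  field
    values<    : a < b
    positions> : v ⟨$⟩ˡ b < v ⟨$⟩ˡ a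

open Inv

Inv? : (v : Permutation′ n) (a b : Fin n) → Dec (Inv v a b)
Inv? v a b = map′ (uncurry inversion) < values< , positions> > ((a <? b) ×-dec (v ⟨$⟩ˡ b <? v ⟨$⟩ˡ a))

infix 4 _⊆ᴵ_
_⊆ᴵ_ : Permutation′ n → Permutation′ n → Set
v ⊆ᴵ w = ∀ {a b} → Inv v a b → Inv w a b

Inv-trans : Inv v a b → Inv v b c → Inv v a c
Inv-trans (inversion a<b vb<va) (inversion b<c vc<vb) = inversion (<-trans a<b b<c) (<-trans vc<vb vb<va)

Inv-at : ∀ {p q} → v ⟨$⟩ʳ p < v ⟨$⟩ʳ q → q < p → Inv v (v ⟨$⟩ʳ p) (v ⟨$⟩ʳ q)
Inv-at {v = v} vp<vq q<p = inversion vp<vq (subst₂ _<_ (sym (inverseˡ v)) (sym (inverseˡ v)) q<p)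

inversionSeq-≡ : (v : Permutation′ n) (b : Fin n) →
                 inversionSeq v b ≡ length (filter (λ a → Inv? v a b) (allFin n))
inversionSeq-≡ v b =
  cong length (trans (filter-filter (_<? b) (λ a → v ⟨$⟩ˡ b <? v ⟨$⟩ˡ a) (allFin _))
                     (filter-≐ (λ a → (a <? b) ×-dec (v ⟨$⟩ˡ b <? v ⟨$⟩ˡ a)) (λ a → Inv? v a b)
                               (uncurry inversion , < values< , positions> >) (allFin _)))

inversionSeq-mono-≤ : (∀ {a} → Inv v a b → Inv w a b) → inversionSeq v b ℕ.≤ inversionSeq w b
inversionSeq-mono-≤ {v = v} {b = b} {w = w} incl =
  subst₂ ℕ._≤_ (sym (inversionSeq-≡ v b)) (sym (inversionSeq-≡ w b))
    (length-filter-mono-≤ (λ a → Inv? v a b) (λ a → Inv? w a b) incl (allFin _))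

inversionSeq-mono-< : (∀ {c} → Inv v c b → Inv w c b) → Inv w a b → ¬ Inv v a b →
                      inversionSeq v b ℕ.< inversionSeq w b
inversionSeq-mono-< {v = v} {b = b} {w = w} {a = a} incl inv ¬inv =
  subst₂ ℕ._<_ (sym (inversionSeq-≡ v b)) (sym (inversionSeq-≡ w b))
    (length-filter-mono-< (λ a → Inv? v a b) (λ a → Inv? w a b) incl (∈-allFin a) inv ¬inv)

⊆ᴵ⇒≤ᴾ : v ⊆ᴵ w → v ≤ᴾ w
⊆ᴵ⇒≤ᴾ v⊆w b = inversionSeq-mono-≤ v⊆w

invCount : Permutation′ n → ℕ
invCount {n} v = length (filter (uncurry (Inv? v)) (cartesianProduct (allFin n) (allFin n)))

invCount-mono-≤ : v ⊆ᴵ w → invCount v ℕ.≤ invCount w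
invCount-mono-≤ {v = v} {w = w} v⊆w =
  length-filter-mono-≤ (uncurry (Inv? v)) (uncurry (Inv? w)) v⊆w (cartesianProduct (allFin _) (allFin _))

invCount-mono-< : v ⊆ᴵ w → Inv w a b → ¬ Inv v a b → invCount v ℕ.< invCount w
invCount-mono-< {v = v} {w = w} {a = a} {b = b} v⊆w =
  length-filter-mono-< (uncurry (Inv? v)) (uncurry (Inv? w)) v⊆w
    (∈-cartesianProduct⁺ (∈-allFin a) (∈-allFin b))

Inv-lower : Avoids132 v → c < a → Inv v a b → Inv v c b
Inv-lower {v = v} {c = c} {a = a} {b = b} av c<a (inversion a<b vb<va) with v ⟨$⟩ˡ b <? v ⟨$⟩ˡ c
... | yes vb<vc = inversion (<-trans c<a a<b) vb<vc
... | no vb≮vc = contradiction (v ⟨$⟩ˡ c , v ⟨$⟩ˡ b , v ⟨$⟩ˡ a , vc<vb , vb<va , c<a′ , a<b′) av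
  where
  -- c, b, a would occur in this order: a 132 pattern
  vc<vb : v ⟨$⟩ˡ c < v ⟨$⟩ˡ b
  vc<vb = ≮∧≢⇒> vb≮vc (<⇒≢ (<-trans c<a a<b) ∘ sym ∘ ⟨$⟩ˡ-injective v)
  c<a′ : v ⟨$⟩ʳ (v ⟨$⟩ˡ c) < v ⟨$⟩ʳ (v ⟨$⟩ˡ a)
  c<a′ = subst₂ _<_ (sym (inverseʳ v)) (sym (inverseʳ v)) c<a
  a<b′ : v ⟨$⟩ʳ (v ⟨$⟩ˡ a) < v ⟨$⟩ʳ (v ⟨$⟩ˡ b)
  a<b′ = subst₂ _<_ (sym (inverseʳ v)) (sym (inverseʳ v)) a<b

≤ᴾ⇒⊆ᴵ : Avoids132 v → Avoids132 w → v ≤ᴾ w → v ⊆ᴵ w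
≤ᴾ⇒⊆ᴵ {v = v} {w = w} av aw v≤w {a} {b} invᵥ with Inv? w a b
... | yes invw = invw
... | no ¬invw = contradiction (v≤w b) (ℕ.<⇒≱ (inversionSeq-mono-< incl invᵥ ¬invw))
  where
  incl : ∀ {c} → Inv w c b → Inv v c b
  incl {c} invw with <-cmp c a
  ... | tri< c<a _ _  = Inv-lower av c<a invᵥ
  ... | tri≈ _ refl _ = contradiction invw ¬invw
  ... | tri> _ _ a<c  = contradiction (Inv-lower aw a<c invw) ¬invw

record Exchanged (i j : Fin n) (v w : Permutation′ n) : Set where
  field
    at-i      : w ⟨$⟩ʳ i ≡ v ⟨$⟩ʳ j
    at-j      : w ⟨$⟩ʳ j ≡ v ⟨$⟩ʳ i
    elsewhere : ∀ k → k ≢ i → k ≢ j → w ⟨$⟩ʳ k ≡ v ⟨$⟩ʳ k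

open Exchanged

Exchanged-sym : Exchanged i j v w → Exchanged i j w v
Exchanged-sym ex .at-i = sym (at-j ex)
Exchanged-sym ex .at-j = sym (at-i ex)
Exchanged-sym ex .elsewhere k k≢i k≢j = sym (elsewhere ex k k≢i k≢j)

Exchanged-swaps : Exchanged i j v w → Swaps i j (λ k → w ⟨$⟩ˡ (v ⟨$⟩ʳ k))
Exchanged-swaps {w = w} ex .map-i = trans (cong (w ⟨$⟩ˡ_) (sym (at-j ex))) (inverseˡ w)
Exchanged-swaps {w = w} ex .map-j = trans (cong (w ⟨$⟩ˡ_) (sym (at-i ex))) (inverseˡ w)
Exchanged-swaps {w = w} ex .map-other {k} k≢i k≢j =
  trans (cong (w ⟨$⟩ˡ_) (sym (elsewhere ex k k≢i k≢j))) (inverseˡ w)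

transpose-exchanged : i ≢ j → Exchanged i j v (transpose i j ∘ₚ v)
transpose-exchanged {v = v} i≢j .at-i = cong (v ⟨$⟩ʳ_) (map-i (transpose-swaps i≢j))
transpose-exchanged {v = v} i≢j .at-j = cong (v ⟨$⟩ʳ_) (map-j (transpose-swaps i≢j))
transpose-exchanged {v = v} i≢j .elsewhere k k≢i k≢j =
  cong (v ⟨$⟩ʳ_) (map-other (transpose-swaps i≢j) k≢i k≢j)

module _ {v w : Permutation′ n} {i j : Fin n}
         (j≡1+i : toℕ j ≡ suc (toℕ i)) (ex : Exchanged i j v w) where

  private
    ⟨$⟩ˡ-via : (u u′ : Permutation′ n) (x : Fin n) → u′ ⟨$⟩ˡ (u ⟨$⟩ʳ (u ⟨$⟩ˡ x)) ≡ u′ ⟨$⟩ˡ x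
    ⟨$⟩ˡ-via u u′ x = cong (u′ ⟨$⟩ˡ_) (inverseʳ u)

  exchange-⊆ᴵ : v ⟨$⟩ʳ i < v ⟨$⟩ʳ j → v ⊆ᴵ w
  exchange-⊆ᴵ vi<vj {a} {b} (inversion a<b vb<va) =
    inversion a<b (subst₂ _<_ (⟨$⟩ˡ-via v w b) (⟨$⟩ˡ-via v w a)
                    (swap-adjacent-< j≡1+i (Exchanged-swaps ex) vb<va not-ij))
    where
    not-ij : ¬ (v ⟨$⟩ˡ b ≡ i × v ⟨$⟩ˡ a ≡ j)
    not-ij (b-at-i , a-at-j) =
      <-asym a<b (subst₂ _<_ (⟨$⟩ˡ≡⇒⟨$⟩ʳ≡ v b-at-i) (⟨$⟩ˡ≡⇒⟨$⟩ʳ≡ v a-at-j) vi<vj)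

  exchange-Inv⁻ : Inv w a b → Inv v a b ⊎ (a ≡ v ⟨$⟩ʳ i × b ≡ v ⟨$⟩ʳ j)
  exchange-Inv⁻ {a} {b} (inversion a<b wb<wa) with (w ⟨$⟩ˡ b ≟ i) ×-dec (w ⟨$⟩ˡ a ≟ j)
  ... | yes (b-at-i , a-at-j) =
    inj₂ ( trans (sym (⟨$⟩ˡ≡⇒⟨$⟩ʳ≡ w a-at-j)) (at-j ex)
         , trans (sym (⟨$⟩ˡ≡⇒⟨$⟩ʳ≡ w b-at-i)) (at-i ex))
  ... | no not-ij =
    inj₁ (inversion a<b (subst₂ _<_ (⟨$⟩ˡ-via w v b) (⟨$⟩ˡ-via w v a)
           (swap-adjacent-< j≡1+i (Exchanged-swaps (Exchanged-sym ex)) wb<wa not-ij)))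

  exchange-Inv : v ⟨$⟩ʳ i < v ⟨$⟩ʳ j → Inv w (v ⟨$⟩ʳ i) (v ⟨$⟩ʳ j)
  exchange-Inv vi<vj = inversion vi<vj
    (subst₂ _<_ (sym (map-j (Exchanged-swaps ex))) (sym (map-i (Exchanged-swaps ex))) (adjacent⇒< j≡1+i))

adjSwapUp-⊆ᴵ : AdjSwapUp v w → v ⊆ᴵ w
adjSwapUp-⊆ᴵ (i , j , j≡1+i , vi<vj , wi≡vj , wj≡vi , w≡v) =
  exchange-⊆ᴵ j≡1+i (record { at-i = wi≡vj ; at-j = wj≡vi ; elsewhere = w≡v }) vi<vj

adjSwapUp-invCount-< : AdjSwapUp v w → invCount v ℕ.< invCount w
adjSwapUp-invCount-< {v = v} {w = w} up@(i , j , j≡1+i , vi<vj , wi≡vj , wj≡vi , w≡v) =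
  invCount-mono-< (adjSwapUp-⊆ᴵ up) (exchange-Inv j≡1+i ex vi<vj) not-Inv
  where
  ex : Exchanged i j v w
  ex = record { at-i = wi≡vj ; at-j = wj≡vi ; elsewhere = w≡v }
  not-Inv : ¬ Inv v (v ⟨$⟩ʳ i) (v ⟨$⟩ʳ j)
  not-Inv ι = <-asym (adjacent⇒< j≡1+i) (subst₂ _<_ (inverseˡ v) (inverseˡ v) (positions> ι))

adjSwapUp-transpose : (i j : Fin n) → toℕ j ≡ suc (toℕ i) → v ⟨$⟩ʳ i < v ⟨$⟩ʳ j →
                      AdjSwapUp v (transpose i j ∘ₚ v)
adjSwapUp-transpose {v = v} i j j≡1+i vi<vj =
  i , j , j≡1+i , vi<vj , at-i ex , at-j ex , elsewhere ex
  where
  ex : Exchanged i j v (transpose i j ∘ₚ v)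
  ex = transpose-exchanged (<⇒≢ (adjacent⇒< j≡1+i))

samePerm⇒⊆ᴵ : SamePerm v w → v ⊆ᴵ w
samePerm⇒⊆ᴵ {v = v} {w = w} v≗w (inversion a<b vb<va) =
  inversion a<b (subst₂ _<_ (same-position _) (same-position _) vb<va)
  where
  same-position : ∀ x → v ⟨$⟩ˡ x ≡ w ⟨$⟩ˡ x
  same-position x = begin
    v ⟨$⟩ˡ x                        ≡⟨ inverseˡ w ⟨
    w ⟨$⟩ˡ (w ⟨$⟩ʳ (v ⟨$⟩ˡ x))      ≡⟨ cong (w ⟨$⟩ˡ_) (v≗w _) ⟨
    w ⟨$⟩ˡ (v ⟨$⟩ʳ (v ⟨$⟩ˡ x))      ≡⟨ cong (w ⟨$⟩ˡ_) (inverseʳ v) ⟩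
    w ⟨$⟩ˡ x                        ∎
    where open ≡-Reasoning

≤ᵂ⇒⊆ᴵ : v ≤ᵂ w → v ⊆ᴵ w
≤ᵂ⇒⊆ᴵ = fold _⊆ᴵ_ (λ step u⊆w ι → u⊆w (weakStep⇒⊆ᴵ step ι)) (λ ι → ι)
  where
  weakStep⇒⊆ᴵ : WeakStep v w → v ⊆ᴵ w
  weakStep⇒⊆ᴵ (inj₁ up)   = adjSwapUp-⊆ᴵ up
  weakStep⇒⊆ᴵ (inj₂ v≗w) = samePerm⇒⊆ᴵ v≗w

InvertedAscent : Permutation′ n → Permutation′ n → Fin n → Fin n → Set
InvertedAscent v w s t = s < t × Inv w (v ⟨$⟩ʳ s) (v ⟨$⟩ʳ t)

invertedAscent-split : v ⊆ᴵ w → s < r → r < t → InvertedAscent v w s t →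
                       InvertedAscent v w s r ⊎ InvertedAscent v w r t
invertedAscent-split {v = v} {w = w} {s = s} {r = r} {t = t} v⊆w s<r r<t (_ , inv-st)
  with Inv? w (v ⟨$⟩ʳ s) (v ⟨$⟩ʳ r)
... | yes inv-sr = inj₁ (s<r , inv-sr)
... | no ¬inv-sr = inj₂ (r<t , inv-rt)
  where
  vs = v ⟨$⟩ʳ s
  vt = v ⟨$⟩ʳ t
  vr = v ⟨$⟩ʳ r
  inv-rt : Inv w vr vt
  inv-rt with <-cmp vr vs
  ... | tri< vr<vs _ _ = Inv-trans (v⊆w (Inv-at vr<vs s<r)) inv-st
  ... | tri≈ _ vr≡vs _ = contradiction (⟨$⟩ʳ-injective v vr≡vs) (<⇒≢ s<r ∘ sym)
  ... | tri> _ _ vs<vr = inversion vr<vt vt-before-vr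
    where
    vs-before-vr : w ⟨$⟩ˡ vs < w ⟨$⟩ˡ vr
    vs-before-vr = ≮∧≢⇒> (¬inv-sr ∘ inversion vs<vr) (<⇒≢ vs<vr ∘ sym ∘ ⟨$⟩ˡ-injective w)
    vt-before-vr : w ⟨$⟩ˡ vt < w ⟨$⟩ˡ vr
    vt-before-vr = <-trans (positions> inv-st) vs-before-vr
    vr<vt : vr < vt
    vr<vt with <-cmp vr vt
    ... | tri< vr<vt _ _ = vr<vt
    ... | tri≈ _ vr≡vt _ = contradiction (⟨$⟩ʳ-injective v vr≡vt) (<⇒≢ r<t)
    ... | tri> _ _ vt<vr = contradiction (positions> (v⊆w (Inv-at vt<vr r<t))) (<-asym vt-before-vr)

successor-before : ∀ {s t : Fin n} k → suc (toℕ s + suc k) ≡ toℕ t →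
                   Σ (Fin n) λ r → toℕ r ≡ suc (toℕ s) × suc (toℕ r + k) ≡ toℕ t
successor-before {n} {s} {t} k t≡ =
  fromℕ< 1+s<n , toℕ-fromℕ< 1+s<n ,
  trans (cong (λ x → suc (x + k)) (toℕ-fromℕ< 1+s<n)) (trans (cong suc (sym (ℕ.+-suc (toℕ s) k))) t≡)
  where
  1+s<n : suc (toℕ s) ℕ.< n
  1+s<n = ℕ.<-trans (subst (suc (toℕ s) ℕ.<_) t≡ (s≤s (ℕ.m<m+n (toℕ s) z<s))) (toℕ<n t)

invertedAscent-adjacent : v ⊆ᴵ w → InvertedAscent v w s t →
                          ∃₂ λ p q → toℕ q ≡ suc (toℕ p) × InvertedAscent v w p q
invertedAscent-adjacent {v = v} {w = w} v⊆w asc@(s<t , _) with ℕ.m≤n⇒∃[o]m+o≡n s<t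
... | k , t≡ = descend k t≡ asc
  where
  descend : ∀ k {s t} → suc (toℕ s + k) ≡ toℕ t → InvertedAscent v w s t →
            ∃₂ λ p q → toℕ q ≡ suc (toℕ p) × InvertedAscent v w p q
  descend zero t≡ asc = _ , _ , trans (sym t≡) (cong suc (ℕ.+-identityʳ _)) , asc
  descend (suc k) t≡ asc with successor-before k t≡
  ... | r , r≡1+s , t≡′ with invertedAscent-split v⊆w (adjacent⇒< r≡1+s)
                               (subst (toℕ r ℕ.<_) t≡′ (s≤s (ℕ.m≤m+n _ k))) asc
  ...   | inj₁ asc′ = _ , r , r≡1+s , asc′
  ...   | inj₂ asc′ = descend k t≡′ asc′

missing⇒invertedAscent : Inv w a b → ¬ Inv v a b → InvertedAscent v w (v ⟨$⟩ˡ a) (v ⟨$⟩ˡ b)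
missing⇒invertedAscent {w = w} {v = v} inv ¬inv =
  ≮∧≢⇒> (¬inv ∘ inversion (values< inv)) (<⇒≢ (values< inv) ∘ sym ∘ ⟨$⟩ˡ-injective v) ,
  subst₂ (Inv w) (sym (inverseʳ v)) (sym (inverseʳ v)) inv

ascend : v ⊆ᴵ w → Inv w a b → ¬ Inv v a b →
         Σ (Permutation′ n) λ v′ → AdjSwapUp v v′ × v′ ⊆ᴵ w
ascend {v = v} {w = w} v⊆w inv ¬inv with invertedAscent-adjacent v⊆w (missing⇒invertedAscent inv ¬inv)
... | p , q , q≡1+p , _ , inv-pq =
  transpose p q ∘ₚ v , adjSwapUp-transpose {v = v} p q q≡1+p (values< inv-pq) , v′⊆w
  where
  v′⊆w : transpose p q ∘ₚ v ⊆ᴵ w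
  v′⊆w ι with exchange-Inv⁻ q≡1+p (transpose-exchanged (<⇒≢ (adjacent⇒< q≡1+p))) ι
  ... | inj₁ ι′          = v⊆w ι′
  ... | inj₂ (refl , refl) = inv-pq

first-difference : (∀ {r} → r < t → u ⟨$⟩ʳ r ≡ v ⟨$⟩ʳ r) → u ⟨$⟩ʳ t ≢ v ⟨$⟩ʳ t →
                   t < v ⟨$⟩ˡ (u ⟨$⟩ʳ t)
first-difference {t = t} {u = u} {v = v} agree differ =
  ≮∧≢⇒> (λ r<t → <⇒≢ r<t (⟨$⟩ʳ-injective u (trans (agree r<t) (inverseʳ v))))
        (λ r≡t → differ (trans (sym (inverseʳ v)) (cong (v ⟨$⟩ʳ_) r≡t)))

⊆ᴵ-antisym : v ⊆ᴵ w → w ⊆ᴵ v → SamePerm v w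
⊆ᴵ-antisym {v = v} {w = w} v⊆w w⊆v = All.wfRec <-wellFounded _ _ agreeAt
  where
  same-order : ∀ {a b} → v ⟨$⟩ˡ a < v ⟨$⟩ˡ b → ¬ w ⟨$⟩ˡ b < w ⟨$⟩ˡ a
  same-order {a} {b} va<vb wb<wa with <-cmp a b
  ... | tri< a<b _ _  = <-asym va<vb (positions> (w⊆v (inversion a<b wb<wa)))
  ... | tri≈ _ refl _ = <-irrefl refl va<vb
  ... | tri> _ _ b<a  = <-asym wb<wa (positions> (v⊆w (inversion b<a va<vb)))

  agreeAt : ∀ q → (∀ {r} → r < q → v ⟨$⟩ʳ r ≡ w ⟨$⟩ʳ r) → v ⟨$⟩ʳ q ≡ w ⟨$⟩ʳ q
  agreeAt q agree with v ⟨$⟩ʳ q ≟ w ⟨$⟩ʳ q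
  ... | yes same = same
  ... | no differ = contradiction w-later (same-order v-later)
    where
    v-later : v ⟨$⟩ˡ (v ⟨$⟩ʳ q) < v ⟨$⟩ˡ (w ⟨$⟩ʳ q)
    v-later = subst (_< v ⟨$⟩ˡ (w ⟨$⟩ʳ q)) (sym (inverseˡ v))
                (first-difference {u = w} {v = v} (sym ∘ agree) (differ ∘ sym))
    w-later : w ⟨$⟩ˡ (w ⟨$⟩ʳ q) < w ⟨$⟩ˡ (v ⟨$⟩ʳ q)
    w-later = subst (_< w ⟨$⟩ˡ (v ⟨$⟩ʳ q)) (sym (inverseˡ w))
                (first-difference {u = v} {v = w} agree differ)

⊆ᴵ-or-missing : (v w : Permutation′ n) → w ⊆ᴵ v ⊎ ∃₂ λ a b → Inv w a b × ¬ Inv v a b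
⊆ᴵ-or-missing v w with any? (λ a → any? (λ b → Inv? w a b ×-dec ¬? (Inv? v a b)))
... | yes (a , b , inv , ¬inv) = inj₂ (a , b , inv , ¬inv)
... | no none =
  inj₁ λ {a} {b} inv → decidable-stable (Inv? v a b) (λ ¬inv → none (a , b , inv , ¬inv))

⊆ᴵ⇒≤ᵂ : v ⊆ᴵ w → v ≤ᵂ w
⊆ᴵ⇒≤ᵂ {w = w} = climb (invCount w) (ℕ.m≤m+n _ _)
  where
  -- Each swap raises invCount v, which never exceeds invCount w, so the fuel k cannot run out.
  climb : ∀ k {v} → invCount w ℕ.≤ k + invCount v → v ⊆ᴵ w → v ≤ᵂ w
  climb k {v} bound v⊆w with ⊆ᴵ-or-missing v w
  ... | inj₁ w⊆v = inj₂ (⊆ᴵ-antisym v⊆w w⊆v) ◅ ε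
  ... | inj₂ (_ , _ , inv , ¬inv) with ascend v⊆w inv ¬inv | k
  ...   | v′ , up , v′⊆w | zero =
    contradiction bound (ℕ.<⇒≱ (ℕ.<-≤-trans (adjSwapUp-invCount-< up) (invCount-mono-≤ v′⊆w)))
  ...   | v′ , up , v′⊆w | suc k = inj₁ up ◅ climb k bound′ v′⊆w
    where
    bound′ : invCount w ℕ.≤ k + invCount v′
    bound′ = ℕ.≤-trans bound (subst (ℕ._≤ k + invCount v′) (ℕ.+-suc k _)
                                     (ℕ.+-monoʳ-≤ k (adjSwapUp-invCount-< up)))

corollary1p11 : (n : ℕ) (v w : Permutation′ n) → Avoids132 v → Avoids132 w →
    (v ≤ᴾ w → v ≤ᵂ w) × (v ≤ᵂ w → v ≤ᴾ w)
corollary1p11 n v w av aw =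
  (λ v≤w → ⊆ᴵ⇒≤ᵂ (≤ᴾ⇒⊆ᴵ av aw v≤w)) , (λ v≤w → ⊆ᴵ⇒≤ᴾ (≤ᵂ⇒⊆ᴵ v≤w))
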